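{- Let $n\geq1$. Let $AV_n(2+2)$ be the set of interval orders $P$ on $[n]=\{1,\dots,n\}$ for which the identity map is an admissible labelling, regarded as subsets of $[n]\times[n]$ and ordered by $P_1\leq_T P_2$ iff $P_1\supseteq P_2$, and let $AV_n(2+2,N)\subseteq AV_n(2+2)$ be the subset of those $P$ which moreover contain no induced subposet isomorphic to $N$. Then the restriction of $\leq_T$ to $AV_n(2+2,N)$ is (isomorphic to) the Tamari lattice of order $n$.
   Context: An interval order is a finite poset with no induced subposet isomorphic to $2+2$ (the disjoint union of two 2-element chains). $N$ is the 4-element fence: elements $a,b,c,d$ with $a<c$, $b<c$, $b<d$ and no other strict relations; posets avoiding both $2+2$ and $N$ are the series parallel interval orders. For a poset $P=(X,\leq)$ and $x\in X$, $I(x)=\{z: z<x\}$, $F(x)=\{z: z>x\}$ (strict), and $x\sim y$ means $I(x)=I(y)$ and $F(x)=F(y)$. A linear extension is a bijection $\lambda:X\to\{1,\dots,|X|\}$ with $x<y\Rightarrow\lambda(x)<\lambda(y)$; it is an admissible labelling if for all $x,y$ with $\lambda(x)<\lambda(y)$, either $I(x)\subset I(y)$, or ($I(x)=I(y)$ and $F(x)\subset F(y)$), or $x\sim y$. The Tamari lattice of order $n$ is the classical lattice on the $C_n$ (Catalan number) binary trees with $n$ internal nodes ordered by right rotation (equivalently on Dyck paths of semilength $n$, or on planar rooted trees with $n+1$ nodes). -}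

module Defs where

open import Data.Nat using (ℕ; zero; suc; _+_; _<_)
open import Data.Fin using (Fin; toℕ)
open import Data.Bool using (Bool; T)
open import Data.Product using (Σ; ∃; _×_; _,_; proj₁)
open import Data.Sum using (_⊎_)
open import Relation.Nullary using (¬_)
open import Relation.Binary.PropositionalEquality using (_≡_; _≢_)
open import Relation.Binary.Construct.Closure.ReflexiveTransitive using (Star)

-- Relations on [n] (elements represented by Fin n, i.e. 0..n-1 for 1..n),
-- viewed as subsets of [n]×[n] via their characteristic function.
-- A poset is given by its strict order relation R (R x y means x < y).

BRel : ℕ → Set
BRel n = Fin n → Fin n → Bool

IsStrictPoset : ∀ {n} → BRel n → Set
IsStrictPoset {n} R =
  (∀ (x : Fin n) → ¬ T (R x x)) ×
  (∀ (x y z : Fin n) → T (R x y) → T (R y z) → T (R x z))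

Incomp : ∀ {n} → BRel n → Fin n → Fin n → Set
Incomp R x y = (x ≢ y) × ¬ T (R x y) × ¬ T (R y x)

Has2+2 : ∀ {n} → BRel n → Set
Has2+2 {n} R = Σ (Fin n) λ a → Σ (Fin n) λ b → Σ (Fin n) λ c → Σ (Fin n) λ d →
  T (R a b) × T (R c d) ×
  Incomp R a c × Incomp R a d × Incomp R b c × Incomp R b d

HasN : ∀ {n} → BRel n → Set
HasN {n} R = Σ (Fin n) λ a → Σ (Fin n) λ b → Σ (Fin n) λ c → Σ (Fin n) λ d →
  T (R a c) × T (R b c) × T (R b d) ×
  Incomp R a b × Incomp R a d × Incomp R c d

IsIntervalOrder : ∀ {n} → BRel n → Set
IsIntervalOrder R = IsStrictPoset R × ¬ Has2+2 R

Pred : ℕ → Set₁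
Pred n = Fin n → Set

_⊆ₚ_ : ∀ {n} → Pred n → Pred n → Set
_⊆ₚ_ {n} A B = ∀ (z : Fin n) → A z → B z

_≐ₚ_ : ∀ {n} → Pred n → Pred n → Set
A ≐ₚ B = (A ⊆ₚ B) × (B ⊆ₚ A)

_⊂ₚ_ : ∀ {n} → Pred n → Pred n → Set
_⊂ₚ_ {n} A B = (A ⊆ₚ B) × Σ (Fin n) λ z → B z × ¬ A z

Ideal : ∀ {n} → BRel n → Fin n → Pred n
Ideal R x z = T (R z x)

Filter : ∀ {n} → BRel n → Fin n → Pred n
Filter R x z = T (R x z)

IdAdmissible : ∀ {n} → BRel n → Set
IdAdmissible {n} R =
  (∀ (x y : Fin n) → T (R x y) → toℕ x < toℕ y) ×
  (∀ (x y : Fin n) → toℕ x < toℕ y →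
     (Ideal R x ⊂ₚ Ideal R y)
     ⊎ ((Ideal R x ≐ₚ Ideal R y) × (Filter R x ⊂ₚ Filter R y))
     ⊎ ((Ideal R x ≐ₚ Ideal R y) × (Filter R x ≐ₚ Filter R y)))

AV22 : ℕ → Set
AV22 n = Σ (BRel n) λ R → IsIntervalOrder R × IdAdmissible R

AV22N : ℕ → Set
AV22N n = Σ (BRel n) λ R → (IsIntervalOrder R × IdAdmissible R) × ¬ HasN R

_≐R_ : ∀ {n} → BRel n → BRel n → Set
_≐R_ {n} R S = ∀ (x y : Fin n) → (T (R x y) → T (S x y)) × (T (S x y) → T (R x y))

_≤T_ : ∀ {n} → AV22N n → AV22N n → Set
_≤T_ {n} P Q = ∀ (x y : Fin n) → T (proj₁ Q x y) → T (proj₁ P x y)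

data BTree : Set where
  leaf : BTree
  node : BTree → BTree → BTree

internal : BTree → ℕ
internal leaf = zero
internal (node l r) = suc (internal l + internal r)

data RotR : BTree → BTree → Set where
  rot    : ∀ {a b c} → RotR (node (node a b) c) (node a (node b c))
  inLeft  : ∀ {a a' b} → RotR a a' → RotR (node a b) (node a' b)
  inRight : ∀ {a b b'} → RotR b b' → RotR (node a b) (node a b')

Tamari : ℕ → Set
Tamari n = Σ BTree λ t → internal t ≡ n

_≤Tam_ : ∀ {n} → Tamari n → Tamari n → Set
s ≤Tam t = Star RotR (proj₁ s) (proj₁ t)

-- Both sides are coded by nested vectors: maps h on [0, n) with x < h x ≤ n whose
-- intervals [x, h x) are pairwise nested or disjoint.
--
-- A binary tree gives its bracket vector, recording where the subtree of each node ends.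
-- This is a bijection onto nested vectors, and s ≤ t in the Tamari order iff the vector
-- of s is pointwise below that of t: a rotation raises the vector at one place, and
-- conversely from any s one climbs by rotations to any pointwise larger nested vector.
--
-- An order P on [n] for which the identity is admissible gives the thresholds
-- h x = least successor of x (or n). Admissibility makes successor sets upward closed, so
-- x < y in P iff h x ≤ y; the intervals of h are nested precisely because P avoids 2+2
-- and N; and P ⊇ Q iff h_P ≤ h_Q pointwise.

module Submission where

open import Defs
open import Data.Nat
open import Data.Nat.Properties
open import Data.Fin as Fin using (Fin; toℕ; fromℕ<)
open import Data.Fin.Properties using (toℕ-fromℕ<; toℕ-injective; toℕ<n; any?)
open import Data.Bool using (Bool; true; false; T)
open import Data.Bool.Properties using (T?)
open import Data.Unit using (tt)
open import Data.Product using (Σ; ∃-syntax; _×_; _,_; proj₁; proj₂)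
open import Data.Sum using (_⊎_; inj₁; inj₂)
open import Data.Empty using (⊥; ⊥-elim)
open import Function using (_∘_)
open import Relation.Nullary using (¬_; Dec; yes; no)
open import Relation.Nullary.Decidable using (_×-dec_)
open import Relation.Binary using (tri<; tri≈; tri>)
open import Relation.Binary.PropositionalEquality
open import Relation.Binary.Construct.Closure.ReflexiveTransitive using (Star; ε; _◅_)

open ≤-Reasoning

infix 4 _≤[_]_ _≗[_]_

_≤[_]_ : (ℕ → ℕ) → ℕ → (ℕ → ℕ) → Set
f ≤[ m ] g = ∀ {x} → x < m → f x ≤ g x

_≗[_]_ : (ℕ → ℕ) → ℕ → (ℕ → ℕ) → Set
f ≗[ m ] g = ∀ {x} → x < m → f x ≡ g x

+-≤⇒≤∸ : ∀ k {m o} → k + m ≤ o → m ≤ o ∸ k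
+-≤⇒≤∸ k {m} le = subst (_≤ _ ∸ k) (m+n∸m≡n k m) (∸-monoˡ-≤ k le)

≤∸⇒+-≤ : ∀ k {m o} → k ≤ o → m ≤ o ∸ k → k + m ≤ o
≤∸⇒+-≤ k k≤o le = subst (k + _ ≤_) (m+[n∸m]≡n k≤o) (+-monoʳ-≤ k le)

⊓-<ʳ : ∀ {m n} → m ⊓ n < n → m < n
⊓-<ʳ {m} {n} lt with n ≤? m
... | yes n≤m = ⊥-elim (<-irrefl (m≥n⇒m⊓n≡n n≤m) lt)
... | no  n≰m = ≰⇒> n≰m

record Nested (m : ℕ) (h : ℕ → ℕ) : Set where
  field
    above   : ∀ {x} → x < m → x < h x
    bounded : ∀ {x} → x < m → h x ≤ m
    nests   : ∀ {x y} → x < m → x < y → y < h x → h y ≤ h x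
open Nested

cap : ℕ → (ℕ → ℕ) → ℕ → ℕ
cap k h x = h x ⊓ k

shift : ℕ → (ℕ → ℕ) → ℕ → ℕ
shift k h y = h (k + y) ∸ k

Nested-cap : ∀ {k m h} → k ≤ m → Nested m h → Nested k (cap k h)
Nested-cap {k} {m} {h} k≤m N = record
  { above   = λ p → ⊓-glb (above N (<-≤-trans p k≤m)) p
  ; bounded = λ {x} _ → m⊓n≤n (h x) k
  ; nests   = λ p x<y y<hx →
      ⊓-monoˡ-≤ k (nests N (<-≤-trans p k≤m) x<y (<-≤-trans y<hx (m⊓n≤m _ k)))
  }

Nested-shift : ∀ k {m h} → Nested (k + m) h → Nested m (shift k h)
Nested-shift k {m} {h} N = record
  { above   = λ {y} p → +-≤⇒≤∸ k (subst (_≤ h (k + y)) (sym (+-suc k y)) (above N (+-monoʳ-< k p)))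
  ; bounded = λ {y} p → m≤n+o⇒m∸n≤o (h (k + y)) k (bounded N (+-monoʳ-< k p))
  ; nests   = λ {y} {y'} p y<y' y'<h → ∸-monoˡ-≤ k
      (nests N (+-monoʳ-< k p) (+-monoʳ-< k y<y')
        (subst (_≤ h (k + y)) (+-suc k y')
          (≤∸⇒+-≤ k (≤-trans (m≤m+n k y) (<⇒≤ (above N (+-monoʳ-< k p)))) y'<h)))
  }

-- Trees and their bracket vectors

-- The nodes of node a b are numbered in order from 0: those of a, then the root
-- (at internal a), then those of b shifted by suc (internal a).
data InOrder (m : ℕ) : ℕ → Set where
  left  : ∀ {x} → x < m → InOrder m x
  root  : InOrder m m
  right : ∀ y → InOrder m (suc (m + y))

inOrder : ∀ m x → InOrder m x
inOrder zero    zero    = root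
inOrder zero    (suc y) = right y
inOrder (suc m) zero    = left z<s
inOrder (suc m) (suc x) with inOrder m x
... | left p  = left (s<s p)
... | root    = root
... | right y = right y

-- reach t x is one past the last node of the subtree rooted at node x.
reach : BTree → ℕ → ℕ
reachNode : (a b : BTree) (x : ℕ) → InOrder (internal a) x → ℕ

reach leaf       _ = 0
reach (node a b) x = reachNode a b x (inOrder (internal a) x)

reachNode a b x (left _)  = reach a x
reachNode a b _ root      = internal (node a b)
reachNode a b _ (right y) = suc (internal a + reach b y)

left<node : ∀ a b {x} → x < internal a → x < internal (node a b)
left<node a b p = <-trans p (s≤s (m≤m+n _ _))

root<node : ∀ a b → internal a < internal (node a b)
root<node a b = s≤s (m≤m+n _ _)

right<node : ∀ a b {y} → y < internal b → suc (internal a + y) < internal (node a b)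
right<node a b p = s<s (+-monoʳ-< (internal a) p)

right<node⁻¹ : ∀ a b {y} → suc (internal a + y) < internal (node a b) → y < internal b
right<node⁻¹ a b p = +-cancelˡ-< (internal a) _ _ (s<s⁻¹ p)

reach-left : ∀ a b {x} → x < internal a → reach (node a b) x ≡ reach a x
reach-left a b {x} x<a with inOrder (internal a) x
... | left _  = refl
... | root    = ⊥-elim (<-irrefl refl x<a)
... | right y = ⊥-elim (<-asym x<a (s≤s (m≤m+n _ y)))

reach-root : ∀ a b {x} → x ≡ internal a → reach (node a b) x ≡ internal (node a b)
reach-root a b {x} x≡a with inOrder (internal a) x
... | left x<a = ⊥-elim (<-irrefl x≡a x<a)
... | root     = refl
... | right y  = ⊥-elim (m≢1+m+n (internal a) (sym x≡a))

reach-right : ∀ a b {x} y → x ≡ suc (internal a + y) → reach (node a b) x ≡ suc (internal a + reach b y)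
reach-right a b {x} y x≡ with inOrder (internal a) x
... | left x<a = ⊥-elim (<-asym x<a (subst (internal a <_) (sym x≡) (s≤s (m≤m+n _ y))))
... | root     = ⊥-elim (m≢1+m+n (internal a) x≡)
... | right y' = cong (λ z → suc (internal a + reach b z)) (+-cancelˡ-≡ (internal a) y' y (suc-injective x≡))

reach-outsideLeft : ∀ {a a'} b {x} → internal a' ≡ internal a → internal a ≤ x →
  reach (node a' b) x ≡ reach (node a b) x
reach-outsideLeft {a} {a'} b {x} e a≤x with inOrder (internal a) x
... | left x<a = ⊥-elim (<⇒≱ x<a a≤x)
... | root     = trans (reach-root a' b (sym e)) (cong (λ k → suc (k + internal b)) e)
... | right y  = trans (reach-right a' b y (cong (λ k → suc (k + y)) (sym e)))
                       (cong (λ k → suc (k + reach b y)) e)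

reach-above : ∀ t {x} → x < internal t → x < reach t x
reach-above (node a b) {x} p with inOrder (internal a) x
... | left q  = reach-above a q
... | root    = root<node a b
... | right y = s<s (+-monoʳ-< (internal a) (reach-above b (right<node⁻¹ a b p)))

reach-bounded : ∀ t {x} → x < internal t → reach t x ≤ internal t
reach-bounded (node a b) {x} p with inOrder (internal a) x
... | left q  = ≤-trans (reach-bounded a q) (<⇒≤ (root<node a b))
... | root    = ≤-refl
... | right y = s≤s (+-monoʳ-≤ (internal a) (reach-bounded b (right<node⁻¹ a b p)))

reach-nests : ∀ t {x y} → x < internal t → x < y → y < reach t x → reach t y ≤ reach t x
reach-nests (node a b) {x} {y} p x<y y<r with inOrder (internal a) x
... | left q = begin
  reach (node a b) y ≡⟨ reach-left a b (<-≤-trans y<r (reach-bounded a q)) ⟩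
  reach a y          ≤⟨ reach-nests a q x<y y<r ⟩
  reach a x          ∎
... | root = reach-bounded (node a b) y<r
... | right x' with inOrder (internal a) y
...   | left y<a = ⊥-elim (<-asym (<-trans (s≤s (m≤m+n _ x')) x<y) y<a)
...   | root     = ⊥-elim (<-irrefl refl (<-trans (s≤s (m≤m+n _ x')) x<y))
...   | right y' = s≤s (+-monoʳ-≤ (internal a)
        (reach-nests b (right<node⁻¹ a b p) (+-cancelˡ-< (internal a) _ _ (s<s⁻¹ x<y))
                       (+-cancelˡ-< (internal a) _ _ (s<s⁻¹ y<r))))

reach-nested : ∀ t → Nested (internal t) (reach t)
reach-nested t = record { above = reach-above t ; bounded = reach-bounded t ; nests = reach-nests t }

leftSize-≮ : ∀ a b c d → internal (node a b) ≡ internal (node c d) →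
  reach (node a b) (internal a) ≡ reach (node c d) (internal a) → ¬ internal a < internal c
leftSize-≮ a b c d e r a<c = <-irrefl refl (begin-strict
  reach (node c d) (internal a) ≡⟨ reach-left c d a<c ⟩
  reach c (internal a)          ≤⟨ reach-bounded c a<c ⟩
  internal c                    <⟨ root<node c d ⟩
  internal (node c d)           ≡⟨ e ⟨
  internal (node a b)           ≡⟨ reach-root a b refl ⟨
  reach (node a b) (internal a) ≡⟨ r ⟩
  reach (node c d) (internal a) ∎)

reach-injective : ∀ s t → internal s ≡ internal t → reach s ≗[ internal s ] reach t → s ≡ t
reach-injective leaf       leaf       _ _ = refl
reach-injective (node a b) (node c d) e r with <-cmp (internal a) (internal c)
... | tri< a<c _ _ = ⊥-elim (leftSize-≮ a b c d e (r (root<node a b)) a<c)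
... | tri> _ _ c<a = ⊥-elim (leftSize-≮ c d a b (sym e) (sym (r (left<node a b c<a))) c<a)
... | tri≈ _ ia≡ic _ = cong₂ node a≡c b≡d
  where
  a≡c : a ≡ c
  a≡c = reach-injective a c ia≡ic λ p → begin-equality
    reach a _          ≡⟨ reach-left a b p ⟨
    reach (node a b) _ ≡⟨ r (left<node a b p) ⟩
    reach (node c d) _ ≡⟨ reach-left c d (subst (_ <_) ia≡ic p) ⟩
    reach c _          ∎
  b≡d : b ≡ d
  b≡d = reach-injective b d (+-cancelˡ-≡ (internal a) _ _ (trans (suc-injective e) (cong (_+ internal d) (sym ia≡ic))))
    λ {y} p → +-cancelˡ-≡ (internal a) _ _ (suc-injective (begin-equality
      suc (internal a + reach b y)             ≡⟨ reach-right a b y refl ⟨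
      reach (node a b) (suc (internal a + y))  ≡⟨ r (right<node a b p) ⟩
      reach (node c d) (suc (internal a + y))  ≡⟨ reach-right c d y (cong (λ k → suc (k + y)) ia≡ic) ⟩
      suc (internal c + reach d y)             ≡⟨ cong (λ k → suc (k + reach d y)) ia≡ic ⟨
      suc (internal a + reach d y)             ∎))

+-suc-reassoc : ∀ a b k → a + suc (b + k) ≡ suc (a + b) + k
+-suc-reassoc a b k = trans (+-suc a (b + k)) (cong suc (sym (+-assoc a b k)))

RotR-internal : ∀ {s s'} → RotR s s' → internal s' ≡ internal s
RotR-internal (rot {a} {b} {c})     = cong suc (+-suc-reassoc (internal a) (internal b) (internal c))
RotR-internal (inLeft {b = b} r)    = cong (λ k → suc (k + internal b)) (RotR-internal r)
RotR-internal (inRight {a = a} r)   = cong (λ k → suc (internal a + k)) (RotR-internal r)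

rot-reach-pivot : ∀ a b c → reach (node (node a b) c) (internal a) < reach (node a (node b c)) (internal a)
rot-reach-pivot a b c = begin-strict
  reach (node (node a b) c) (internal a) ≡⟨ reach-left (node a b) c (root<node a b) ⟩
  reach (node a b) (internal a)          ≡⟨ reach-root a b refl ⟩
  suc (internal a + internal b)          <⟨ s<s (+-monoʳ-< (internal a) (s≤s (m≤m+n _ _))) ⟩
  internal (node a (node b c))           ≡⟨ reach-root a (node b c) refl ⟨
  reach (node a (node b c)) (internal a) ∎

rot-reach-elsewhere : ∀ a b c {x} → x ≢ internal a →
  reach (node a (node b c)) x ≡ reach (node (node a b) c) x
rot-reach-elsewhere a b c {x} x≢a with inOrder (internal a) x
... | left p = sym (trans (reach-left (node a b) c (left<node a b p)) (reach-left a b p))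
... | root   = ⊥-elim (x≢a refl)
... | right y with inOrder (internal b) y
...   | left q   = sym (trans (reach-left (node a b) c (right<node a b q)) (reach-right a b y refl))
...   | root     = sym (trans (reach-root (node a b) c refl) (sym (RotR-internal (rot {a} {b} {c}))))
...   | right z  = sym (trans (reach-right (node a b) c z (cong suc (+-suc-reassoc (internal a) (internal b) z)))
                              (cong suc (sym (+-suc-reassoc (internal a) (internal b) (reach c z)))))

reach-node-≤ : ∀ {a a' b b'} → internal a' ≡ internal a → internal b' ≡ internal b →
  reach a ≤[ internal a ] reach a' → reach b ≤[ internal b ] reach b' →
  reach (node a b) ≤[ internal (node a b) ] reach (node a' b')
reach-node-≤ {a} {a'} {b} {b'} ea eb la lb {x} p with inOrder (internal a) x
... | left q = begin
  reach a x           ≤⟨ la q ⟩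
  reach a' x          ≡⟨ reach-left a' b' (subst (x <_) (sym ea) q) ⟨
  reach (node a' b') x ∎
... | root = ≤-reflexive (sym (trans (reach-root a' b' (sym ea)) (cong₂ (λ u v → suc (u + v)) ea eb)))
... | right y = begin
  suc (internal a + reach b y)              ≤⟨ s≤s (+-monoʳ-≤ (internal a) (lb (right<node⁻¹ a b p))) ⟩
  suc (internal a + reach b' y)             ≡⟨ cong (λ k → suc (k + reach b' y)) ea ⟨
  suc (internal a' + reach b' y)            ≡⟨ reach-right a' b' y (cong (λ k → suc (k + y)) (sym ea)) ⟨
  reach (node a' b') (suc (internal a + y)) ∎

RotR-reach-≤ : ∀ {s s'} → RotR s s' → reach s ≤[ internal s ] reach s'
RotR-reach-≤ (rot {a} {b} {c}) {x} _ with x ≟ internal a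
... | yes refl = <⇒≤ (rot-reach-pivot a b c)
... | no  x≢a  = ≤-reflexive (sym (rot-reach-elsewhere a b c x≢a))
RotR-reach-≤ (inLeft r)  = reach-node-≤ (RotR-internal r) refl (RotR-reach-≤ r) (λ _ → ≤-refl)
RotR-reach-≤ (inRight r) = reach-node-≤ refl (RotR-internal r) (λ _ → ≤-refl) (RotR-reach-≤ r)

RotR-reach-< : ∀ {s s'} → RotR s s' → ∃[ x ] x < internal s × reach s x < reach s' x
RotR-reach-< (rot {a} {b} {c}) = internal a , left<node (node a b) c (root<node a b) , rot-reach-pivot a b c
RotR-reach-< (inLeft {a} {a'} {b} r) with RotR-reach-< r
... | x , p , lt = x , left<node a b p ,
  subst₂ _<_ (sym (reach-left a b p)) (sym (reach-left a' b (subst (x <_) (sym (RotR-internal r)) p))) lt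
RotR-reach-< (inRight {a} {b} {b'} r) with RotR-reach-< r
... | y , p , lt = suc (internal a + y) , right<node a b p ,
  subst₂ _<_ (sym (reach-right a b y refl)) (sym (reach-right a b' y refl)) (s<s (+-monoʳ-< (internal a) lt))

Star-reach-≤ : ∀ {s t} → Star RotR s t → reach s ≤[ internal s ] reach t
Star-reach-≤ ε        _ = ≤-refl
Star-reach-≤ (r ◅ rs) p = ≤-trans (RotR-reach-≤ r p) (Star-reach-≤ rs (subst (_ <_) (sym (RotR-internal r)) p))

-- Reaching a nested vector by rotations

data Progress (s : BTree) (h : ℕ → ℕ) : Set where
  reached : reach s ≗[ internal s ] h → Progress s h
  rotates : ∀ {s'} → RotR s s' → reach s' ≤[ internal s ] h → Progress s h

module SplitAtRoot {a b : BTree} {h : ℕ → ℕ} (N : Nested (internal (node a b)) h)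
               (below : reach (node a b) ≤[ internal (node a b) ] h) where

  root-≤ : internal (node a b) ≤ h (internal a)
  root-≤ = subst (_≤ h (internal a)) (reach-root a b refl) (below (root<node a b))

  right-≥ : ∀ {y} → y < internal b → suc (internal a) ≤ h (suc (internal a + y))
  right-≥ p = ≤-trans (s≤s (m≤m+n _ _)) (<⇒≤ (above N (right<node a b p)))

  nestedˡ : Nested (internal a) (cap (internal a) h)
  nestedˡ = Nested-cap (<⇒≤ (root<node a b)) N

  nestedʳ : Nested (internal b) (shift (suc (internal a)) h)
  nestedʳ = Nested-shift (suc (internal a)) N

  belowˡ : reach a ≤[ internal a ] cap (internal a) h
  belowˡ {x} p = ⊓-glb (subst (_≤ h x) (reach-left a b p) (below (left<node a b p))) (reach-bounded a p)

  belowʳ : reach b ≤[ internal b ] shift (suc (internal a)) h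
  belowʳ {y} p = +-≤⇒≤∸ (suc (internal a)) (subst (_≤ h _) (reach-right a b y refl) (below (right<node a b p)))

  rotateˡ : ∀ {a'} → RotR a a' → reach a' ≤[ internal a ] cap (internal a) h → Progress (node a b) h
  rotateˡ {a'} r le = rotates (inLeft r) bound
    where
    bound : reach (node a' b) ≤[ internal (node a b) ] h
    bound {x} p with x <? internal a
    ... | yes q = begin
      reach (node a' b) x ≡⟨ reach-left a' b (subst (x <_) (sym (RotR-internal r)) q) ⟩
      reach a' x          ≤⟨ le q ⟩
      h x ⊓ internal a    ≤⟨ m⊓n≤m (h x) _ ⟩
      h x                 ∎
    ... | no q = subst (_≤ h x) (sym (reach-outsideLeft b (RotR-internal r) (≮⇒≥ q))) (below p)

  rotateʳ : ∀ {b'} → RotR b b' → reach b' ≤[ internal b ] shift (suc (internal a)) h → Progress (node a b) h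
  rotateʳ {b'} r le = rotates (inRight r) bound
    where
    bound : reach (node a b') ≤[ internal (node a b) ] h
    bound {x} p with inOrder (internal a) x
    ... | left q  = subst (_≤ h x) (reach-left a b q) (below p)
    ... | root    = subst (_≤ h (internal a)) (sym (RotR-internal (inRight {a} r))) root-≤
    ... | right y = ≤∸⇒+-≤ (suc (internal a)) (right-≥ q) (le q)
      where
      q : y < internal b
      q = right<node⁻¹ a b p

  reachedIfBounded : reach a ≗[ internal a ] cap (internal a) h →
    reach b ≗[ internal b ] shift (suc (internal a)) h →
    (∀ {x} → x < internal a → h x ≤ internal a) → Progress (node a b) h
  reachedIfBounded eqˡ eqʳ bnd = reached eq
    where
    eq : reach (node a b) ≗[ internal (node a b) ] h
    eq {x} p with inOrder (internal a) x
    ... | left q  = trans (eqˡ q) (m≤n⇒m⊓n≡m (bnd q))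
    ... | root    = ≤-antisym root-≤ (bounded N p)
    ... | right y = trans (cong (λ z → suc (internal a + z)) (eqʳ q)) (m+[n∸m]≡n (right-≥ q))
      where
      q : y < internal b
      q = right<node⁻¹ a b p

module _ {a₁ a₂ b : BTree} {h : ℕ → ℕ} (N : Nested (internal (node (node a₁ a₂) b)) h)
         (below : reach (node (node a₁ a₂) b) ≤[ internal (node (node a₁ a₂) b) ] h) where

  open SplitAtRoot {node a₁ a₂} {b} N below using (root-≤)

  private
    pivot<node : internal a₁ < internal (node (node a₁ a₂) b)
    pivot<node = left<node (node a₁ a₂) b (root<node a₁ a₂)

  -- Rotating at the root only raises reach at the pivot internal a₁, to the full size,
  -- which h (internal a₁) dominates by nesting against the root of the left subtree.
  rotate-root-≤ : internal (node a₁ a₂) < h (internal a₁) →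
    reach (node a₁ (node a₂ b)) ≤[ internal (node (node a₁ a₂) b) ] h
  rotate-root-≤ pivot {x} p with x ≟ internal a₁
  ... | no x≢ = subst (_≤ h x) (sym (rot-reach-elsewhere a₁ a₂ b x≢)) (below p)
  ... | yes refl = begin
    reach (node a₁ (node a₂ b)) (internal a₁) ≡⟨ reach-root a₁ (node a₂ b) refl ⟩
    internal (node a₁ (node a₂ b))            ≡⟨ RotR-internal rot ⟩
    internal (node (node a₁ a₂) b)            ≤⟨ root-≤ ⟩
    h (internal (node a₁ a₂))                 ≤⟨ nests N pivot<node (root<node a₁ a₂) pivot ⟩
    h (internal a₁)                           ∎

  left-bounded : reach (node a₁ a₂) ≗[ internal (node a₁ a₂) ] cap (internal (node a₁ a₂)) h →
    h (internal a₁) ≤ internal (node a₁ a₂) →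
    ∀ {x} → x < internal (node a₁ a₂) → h x ≤ internal (node a₁ a₂)
  left-bounded eqˡ pivot {x} p with <-cmp x (internal a₁)
  ... | tri≈ _ refl _ = pivot
  ... | tri> _ _ w<x  = ≤-trans (nests N pivot<node w<x (<-≤-trans p node≤pivot)) pivot
    where
    node≤pivot : internal (node a₁ a₂) ≤ h (internal a₁)
    node≤pivot = begin
      internal (node a₁ a₂)                    ≡⟨ reach-root a₁ a₂ refl ⟨
      reach (node a₁ a₂) (internal a₁)         ≡⟨ reach-left (node a₁ a₂) b (root<node a₁ a₂) ⟨
      reach (node (node a₁ a₂) b) (internal a₁) ≤⟨ below pivot<node ⟩
      h (internal a₁)                          ∎
  ... | tri< x<w _ _  = <⇒≤ (⊓-<ʳ (begin-strict
    h x ⊓ internal (node a₁ a₂) ≡⟨ eqˡ p ⟨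
    reach (node a₁ a₂) x        ≡⟨ reach-left a₁ a₂ x<w ⟩
    reach a₁ x                  ≤⟨ reach-bounded a₁ x<w ⟩
    internal a₁                 <⟨ root<node a₁ a₂ ⟩
    internal (node a₁ a₂)       ∎))

-- Once both subtrees match, h is matched unless it exceeds the left subtree at that
-- subtree's root, and then the rotation at the root of the whole tree is available.
settle : ∀ a {b h} (N : Nested (internal (node a b)) h) (below : reach (node a b) ≤[ internal (node a b) ] h) →
  reach a ≗[ internal a ] cap (internal a) h → reach b ≗[ internal b ] shift (suc (internal a)) h →
  Progress (node a b) h
settle leaf {b} N below eqˡ eqʳ = SplitAtRoot.reachedIfBounded {leaf} {b} N below eqˡ eqʳ λ ()
settle (node a₁ a₂) {b} {h} N below eqˡ eqʳ with h (internal a₁) ≤? internal (node a₁ a₂)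
... | yes pivot = SplitAtRoot.reachedIfBounded {node a₁ a₂} {b} N below eqˡ eqʳ (left-bounded N below eqˡ pivot)
... | no  pivot = rotates rot (rotate-root-≤ N below (≰⇒> pivot))

progress : ∀ s h → Nested (internal s) h → reach s ≤[ internal s ] h → Progress s h
progress leaf       h N below = reached λ ()
progress (node a b) h N below = viaLeft (progress a _ nestedˡ belowˡ)
  where
  open SplitAtRoot {a} {b} N below
  viaRight : reach a ≗[ internal a ] cap (internal a) h → Progress b (shift (suc (internal a)) h) → Progress (node a b) h
  viaRight _   (rotates r le) = rotateʳ r le
  viaRight eqˡ (reached eqʳ)  = settle a N below eqˡ eqʳ
  viaLeft : Progress a (cap (internal a) h) → Progress (node a b) h
  viaLeft (rotates r le) = rotateˡ r le
  viaLeft (reached eqˡ)  = viaRight eqˡ (progress b _ nestedʳ belowʳ)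

sumBelow : ℕ → (ℕ → ℕ) → ℕ
sumBelow zero    f = 0
sumBelow (suc m) f = sumBelow m f + f m

sumBelow-mono-≤ : ∀ m {f g} → f ≤[ m ] g → sumBelow m f ≤ sumBelow m g
sumBelow-mono-≤ zero    le = z≤n
sumBelow-mono-≤ (suc m) le = +-mono-≤ (sumBelow-mono-≤ m (le ∘ m<n⇒m<1+n)) (le (n<1+n m))

sumBelow-mono-< : ∀ m {f g x} → f ≤[ m ] g → x < m → f x < g x → sumBelow m f < sumBelow m g
sumBelow-mono-< (suc m) {x = x} le x<1+m lt with m≤n⇒m<n∨m≡n (s≤s⁻¹ x<1+m)
... | inj₁ x<m  = +-mono-<-≤ (sumBelow-mono-< m (le ∘ m<n⇒m<1+n) x<m lt) (le (n<1+n m))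
... | inj₂ refl = +-mono-≤-< (sumBelow-mono-≤ m (le ∘ m<n⇒m<1+n)) lt

Climbs : BTree → ℕ → (ℕ → ℕ) → Set
Climbs s n h = ∃[ t ] Star RotR s t × internal t ≡ n × reach t ≗[ n ] h

-- Each rotation strictly raises the total reach, which stays below the total of h.
approach : ∀ {n h} → Nested n h → ∀ fuel s → internal s ≡ n → reach s ≤[ n ] h →
  sumBelow n h ∸ sumBelow n (reach s) < fuel → Climbs s n h
approach N zero       _ _    _     ()
approach N (suc fuel) s refl below gap with progress s _ N below
... | reached eq = s , ε , refl , eq
... | rotates {s'} r below' with RotR-reach-< r
...   | x , p , lt with approach N fuel s' (RotR-internal r) below'
        (<-≤-trans (∸-monoʳ-< (sumBelow-mono-< _ (RotR-reach-≤ r) p lt) (sumBelow-mono-≤ _ below'))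
                   (s≤s⁻¹ gap))
...     | t , rs , e , eq = t , r ◅ rs , e , eq

climb : ∀ {n h} → Nested n h → ∀ s → internal s ≡ n → reach s ≤[ n ] h → Climbs s n h
climb N s e below = approach N _ s e below (n<1+n _)

leftComb : ℕ → BTree
leftComb zero    = leaf
leftComb (suc n) = node (leftComb n) leaf

internal-leftComb : ∀ n → internal (leftComb n) ≡ n
internal-leftComb zero    = refl
internal-leftComb (suc n) = cong suc (trans (+-identityʳ _) (internal-leftComb n))

reach-leftComb : ∀ n → reach (leftComb n) ≗[ n ] suc
reach-leftComb (suc n) {x} x<1+n with m≤n⇒m<n∨m≡n (s≤s⁻¹ x<1+n)
... | inj₁ x<n  = trans (reach-left (leftComb n) leaf (subst (x <_) (sym (internal-leftComb n)) x<n))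
                        (reach-leftComb n x<n)
... | inj₂ refl = trans (reach-root (leftComb x) leaf (sym (internal-leftComb x)))
                        (cong suc (trans (+-identityʳ _) (internal-leftComb x)))

nested⇒tree : ∀ {n h} → Nested n h → ∃[ t ] internal t ≡ n × reach t ≗[ n ] h
nested⇒tree {n} N with climb N (leftComb n) (internal-leftComb n) (λ p → ≤-trans (≤-reflexive (reach-leftComb n p)) (above N p))
... | t , _ , e , eq = t , e , eq

reach-≤⇒Star : ∀ {n s t} → internal s ≡ n → internal t ≡ n → reach s ≤[ n ] reach t → Star RotR s t
reach-≤⇒Star {n} {s} {t} es et le
  with climb (subst (λ m → Nested m (reach t)) et (reach-nested t)) s es le
... | t' , rs , et' , eq =
  subst (Star RotR s) (reach-injective t' t (trans et' (sym et)) (eq ∘ subst (_ <_) et')) rs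

Tamari-injective : ∀ {n} (s t : Tamari n) → reach (proj₁ s) ≗[ n ] reach (proj₁ t) → s ≡ t
Tamari-injective (s , refl) (t , et) eq with reach-injective s t (sym et) eq
... | refl = cong (s ,_) (≡-irrelevant refl et)

≤Tam⇒reach-≤ : ∀ {n} (s t : Tamari n) → s ≤Tam t → reach (proj₁ s) ≤[ n ] reach (proj₁ t)
≤Tam⇒reach-≤ (s , refl) _ = Star-reach-≤

reach-≤⇒≤Tam : ∀ {n} (s t : Tamari n) → reach (proj₁ s) ≤[ n ] reach (proj₁ t) → s ≤Tam t
reach-≤⇒≤Tam (s , refl) (t , et) = reach-≤⇒Star refl et

-- Interval orders of nested vectors

asFin : ∀ {n x} → x < n → ∃[ i ] toℕ i ≡ x
asFin p = fromℕ< p , toℕ-fromℕ< p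

≤[]-fromFin : ∀ {n f g} → (∀ (i : Fin n) → f (toℕ i) ≤ g (toℕ i)) → f ≤[ n ] g
≤[]-fromFin le p with asFin p
... | i , refl = le i

≗[]-fromFin : ∀ {n f g} → (∀ (i : Fin n) → f (toℕ i) ≡ g (toℕ i)) → f ≗[ n ] g
≗[]-fromFin eq p with asFin p
... | i , refl = eq i

extend : ∀ {n} → (Fin n → ℕ) → ℕ → ℕ
extend {zero}  _ _       = 0
extend {suc n} h zero    = h Fin.zero
extend {suc n} h (suc x) = extend (h ∘ Fin.suc) x

extend-toℕ : ∀ {n} (h : Fin n → ℕ) i → extend h (toℕ i) ≡ h i
extend-toℕ h Fin.zero    = refl
extend-toℕ h (Fin.suc i) = extend-toℕ (h ∘ Fin.suc) i

extend-nested : ∀ {n} {h : Fin n → ℕ} → (∀ i → toℕ i < h i) → (∀ i → h i ≤ n) →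
  (∀ i j → toℕ i < toℕ j → toℕ j < h i → h j ≤ h i) → Nested n (extend h)
extend-nested {n} {h} ab bd ns = record { above = aboveℕ ; bounded = boundedℕ ; nests = nestsℕ }
  where
  aboveℕ : ∀ {x} → x < n → x < extend h x
  aboveℕ p with asFin p
  ... | i , refl rewrite extend-toℕ h i = ab i
  boundedℕ : ∀ {x} → x < n → extend h x ≤ n
  boundedℕ p with asFin p
  ... | i , refl rewrite extend-toℕ h i = bd i
  nestsℕ : ∀ {x y} → x < n → x < y → y < extend h x → extend h y ≤ extend h x
  nestsℕ p x<y y<hx with asFin p
  ... | i , refl with asFin (<-≤-trans y<hx (boundedℕ p))
  ...   | j , refl rewrite extend-toℕ h i | extend-toℕ h j = ns i j x<y y<hx

nestedOrder : ∀ {n} → (ℕ → ℕ) → BRel n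
nestedOrder h x y = h (toℕ x) ≤ᵇ toℕ y

module NestedOrder {n} {h : ℕ → ℕ} (N : Nested n h) where

  private
    R : BRel n
    R = nestedOrder h

    _≺_ : Fin n → Fin n → Set
    x ≺ y = T (R x y)

    ≺⇒≤ : ∀ {x y} → x ≺ y → h (toℕ x) ≤ toℕ y
    ≺⇒≤ = ≤ᵇ⇒≤ _ _

    ⊀⇒> : ∀ {x y} → ¬ x ≺ y → toℕ y < h (toℕ x)
    ⊀⇒> x⊀y = ≰⇒> (x⊀y ∘ ≤⇒≤ᵇ)

    above′ : ∀ x → toℕ x < h (toℕ x)
    above′ x = above N (toℕ<n x)

  isStrictPoset : IsStrictPoset R
  isStrictPoset = (λ x x≺x → <⇒≱ (above′ x) (≺⇒≤ x≺x))
                , (λ x y z x≺y y≺z → ≤⇒≤ᵇ (≤-trans (≺⇒≤ x≺y) (<⇒≤ (<-≤-trans (above′ y) (≺⇒≤ y≺z)))))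

  no2+2 : ¬ Has2+2 R
  no2+2 (a , b , c , d , a≺b , c≺d , _ , (_ , a⊀d , _) , (_ , _ , c⊀b) , _) = <-irrefl refl (begin-strict
    h (toℕ c) ≤⟨ ≺⇒≤ c≺d ⟩
    toℕ d     <⟨ ⊀⇒> a⊀d ⟩
    h (toℕ a) ≤⟨ ≺⇒≤ a≺b ⟩
    toℕ b     <⟨ ⊀⇒> c⊀b ⟩
    h (toℕ c) ∎)

  noN : ¬ HasN R
  noN (a , b , c , d , a≺c , _ , b≺d , (a≢b , _ , b⊀a) , (_ , a⊀d , _) , (_ , _ , d⊀c))
    with <-cmp (toℕ a) (toℕ b)
  ... | tri≈ _ a≡b _ = a≢b (toℕ-injective a≡b)
  ... | tri< a<b _ _ = <-irrefl refl (begin-strict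
    h (toℕ d) ≤⟨ nests N (toℕ<n a) a<d (⊀⇒> a⊀d) ⟩
    h (toℕ a) ≤⟨ ≺⇒≤ a≺c ⟩
    toℕ c     <⟨ ⊀⇒> d⊀c ⟩
    h (toℕ d) ∎)
    where
    a<d : toℕ a < toℕ d
    a<d = <-trans a<b (<-≤-trans (above′ b) (≺⇒≤ b≺d))
  ... | tri> _ _ b<a = <-irrefl refl (begin-strict
    h (toℕ a) ≤⟨ nests N (toℕ<n b) b<a (⊀⇒> b⊀a) ⟩
    h (toℕ b) ≤⟨ ≺⇒≤ b≺d ⟩
    toℕ d     <⟨ ⊀⇒> a⊀d ⟩
    h (toℕ a) ∎)

  admissible : IdAdmissible R
  admissible = (λ x y x≺y → <-≤-trans (above′ x) (≺⇒≤ x≺y)) , compareLabels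
    where
    ideal-⊆ : ∀ {x y} → toℕ x < toℕ y → Ideal R x ⊆ₚ Ideal R y
    ideal-⊆ x<y z z≺x = ≤⇒≤ᵇ (≤-trans (≺⇒≤ z≺x) (<⇒≤ x<y))

    compareLabels : ∀ x y → toℕ x < toℕ y →
      (Ideal R x ⊂ₚ Ideal R y)
      ⊎ ((Ideal R x ≐ₚ Ideal R y) × (Filter R x ⊂ₚ Filter R y))
      ⊎ ((Ideal R x ≐ₚ Ideal R y) × (Filter R x ≐ₚ Filter R y))
    compareLabels x y x<y with any? (λ z → (toℕ x <? h (toℕ z)) ×-dec (h (toℕ z) ≤? toℕ y))
    ... | yes (z , x<hz , hz≤y) = inj₁ (ideal-⊆ x<y , z , ≤⇒≤ᵇ hz≤y , λ z≺x → <⇒≱ x<hz (≺⇒≤ z≺x))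
    ... | no none = inj₂ (filters (h (toℕ y) <? h (toℕ x)))
      where
      ideals : Ideal R x ≐ₚ Ideal R y
      ideals = ideal-⊆ x<y , λ z z≺y → ≤⇒≤ᵇ (≮⇒≥ λ x<hz → none (z , x<hz , ≺⇒≤ z≺y))

      hy≤hx : h (toℕ y) ≤ h (toℕ x)
      hy≤hx = nests N (toℕ<n x) x<y (≰⇒> λ hx≤y → none (x , above′ x , hx≤y))

      filter-⊆ : Filter R x ⊆ₚ Filter R y
      filter-⊆ z x≺z = ≤⇒≤ᵇ (≤-trans hy≤hx (≺⇒≤ x≺z))

      filters : Dec (h (toℕ y) < h (toℕ x)) →
        ((Ideal R x ≐ₚ Ideal R y) × (Filter R x ⊂ₚ Filter R y))
        ⊎ ((Ideal R x ≐ₚ Ideal R y) × (Filter R x ≐ₚ Filter R y))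
      filters (yes hy<hx) = inj₁ (ideals , filter-⊆ , w , ≤⇒≤ᵇ (≤-reflexive (sym (toℕ-fromℕ< hy<n))) ,
                                 λ x≺w → <⇒≱ hy<hx (subst (h (toℕ x) ≤_) (toℕ-fromℕ< hy<n) (≺⇒≤ x≺w)))
        where
        hy<n : h (toℕ y) < n
        hy<n = <-≤-trans hy<hx (bounded N (toℕ<n x))
        w : Fin n
        w = fromℕ< hy<n
      filters (no hy≮hx) = inj₂ (ideals , filter-⊆ , λ z y≺z → ≤⇒≤ᵇ (≤-trans (≮⇒≥ hy≮hx) (≺⇒≤ y≺z)))

  av22n : AV22N n
  av22n = nestedOrder h , ((isStrictPoset , no2+2) , admissible) , noN

-- Thresholds of admissibly labelled orders

-- The least index at which p holds, or n if there is none.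
firstTrue : ∀ {n} → (Fin n → Bool) → ℕ
firstTrue {zero}  p = 0
firstTrue {suc n} p with p Fin.zero
... | true  = 0
... | false = suc (firstTrue (p ∘ Fin.suc))

firstTrue-≤ : ∀ {n} (p : Fin n → Bool) → firstTrue p ≤ n
firstTrue-≤ {zero}  p = z≤n
firstTrue-≤ {suc n} p with p Fin.zero
... | true  = z≤n
... | false = s≤s (firstTrue-≤ (p ∘ Fin.suc))

firstTrue-minimal : ∀ {n} (p : Fin n → Bool) {y} → T (p y) → firstTrue p ≤ toℕ y
firstTrue-minimal {suc n} p {y} py with p Fin.zero in p0
... | true = z≤n
firstTrue-minimal {suc n} p {Fin.zero}  py | false rewrite p0 = ⊥-elim py
firstTrue-minimal {suc n} p {Fin.suc y} py | false = s≤s (firstTrue-minimal (p ∘ Fin.suc) py)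

firstTrue-holds : ∀ {n} (p : Fin n → Bool) → firstTrue p < n → ∃[ i ] toℕ i ≡ firstTrue p × T (p i)
firstTrue-holds {suc n} p lt with p Fin.zero in p0
... | true = Fin.zero , refl , subst T (sym p0) tt
... | false with firstTrue-holds (p ∘ Fin.suc) (s<s⁻¹ lt)
...   | i , eq , pi = Fin.suc i , cong suc eq , pi

threshold : ∀ {n} → BRel n → Fin n → ℕ
threshold R x = firstTrue (R x)

R⇒threshold-≤ : ∀ {n} (R : BRel n) {x y} → T (R x y) → threshold R x ≤ toℕ y
R⇒threshold-≤ R = firstTrue-minimal (R _)

module Admissible {n} {R : BRel n} (adm : IdAdmissible R) where

  ideal-increasing : ∀ {y y'} → toℕ y < toℕ y' → Ideal R y ⊆ₚ Ideal R y'
  ideal-increasing {y} {y'} y<y' with proj₂ adm y y' y<y'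
  ... | inj₁ (I⊆ , _)               = I⊆
  ... | inj₂ (inj₁ ((I⊆ , _) , _)) = I⊆
  ... | inj₂ (inj₂ ((I⊆ , _) , _)) = I⊆

  upward-closed : ∀ {x y y'} → T (R x y) → toℕ y ≤ toℕ y' → T (R x y')
  upward-closed {x} {y} {y'} x≺y y≤y' with m≤n⇒m<n∨m≡n y≤y'
  ... | inj₁ y<y' = ideal-increasing y<y' x x≺y
  ... | inj₂ y≡y' = subst (T ∘ R x) (toℕ-injective y≡y') x≺y

  threshold-≤⇒R : ∀ {x y} → threshold R x ≤ toℕ y → T (R x y)
  threshold-≤⇒R {x} {y} θ≤y with firstTrue-holds (R x) (≤-<-trans θ≤y (toℕ<n y))
  ... | w , w≡θ , x≺w = upward-closed x≺w (subst (_≤ toℕ y) (sym w≡θ) θ≤y)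

  threshold-above : ∀ x → toℕ x < threshold R x
  threshold-above x with n ≤? threshold R x
  ... | yes n≤θ = <-≤-trans (toℕ<n x) n≤θ
  ... | no  n≰θ with firstTrue-holds (R x) (≰⇒> n≰θ)
  ...   | w , w≡θ , x≺w = subst (toℕ x <_) w≡θ (proj₁ adm x w x≺w)

module _ {n} {R : BRel n} (transitive : ∀ x y z → T (R x y) → T (R y z) → T (R x z))
         (no2+2 : ¬ Has2+2 R) (noN : ¬ HasN R) (adm : IdAdmissible R) where

  private
    increasing : ∀ x y → T (R x y) → toℕ x < toℕ y
    increasing = proj₁ adm

    Incomp-sym : ∀ {x y} → Incomp R x y → Incomp R y x
    Incomp-sym (x≢y , x⊀y , y⊀x) = x≢y ∘ sym , y⊀x , x⊀y

    label<⇒Incomp : ∀ {x y} → toℕ x < toℕ y → ¬ T (R x y) → Incomp R x y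
    label<⇒Incomp x<y x⊀y = (λ { refl → <-irrefl refl x<y }) , x⊀y , λ y≺x → <-asym x<y (increasing _ _ y≺x)

  -- If y ⊀ w, admissibility of x < y cannot come from F(x) ⊆ F(y), so some z ≺ y has z ⊀ x;
  -- then x, y, z, w span an N (if z ≺ w) or a 2+2 (if not).
  successor-shared : ∀ {x y w} → toℕ x < toℕ y → ¬ T (R x y) → T (R x w) → toℕ y < toℕ w → T (R y w)
  successor-shared {x} {y} {w} x<y x⊀y x≺w y<w with T? (R y w)
  ... | yes y≺w = y≺w
  ... | no  y⊀w with proj₂ adm x y x<y
  ...   | inj₂ (inj₁ (_ , F⊆ , _)) = F⊆ w x≺w
  ...   | inj₂ (inj₂ (_ , F⊆ , _)) = F⊆ w x≺w
  ...   | inj₁ (_ , z , z≺y , z⊀x) = ⊥-elim (forbidden (T? (R z w)))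
    where
    x∥y : Incomp R x y
    x∥y = label<⇒Incomp x<y x⊀y
    y∥w : Incomp R y w
    y∥w = label<⇒Incomp y<w y⊀w
    x∥z : Incomp R x z
    x∥z = (λ { refl → x⊀y z≺y }) , (λ x≺z → x⊀y (transitive x z y x≺z z≺y)) , z⊀x
    w⊀y : ¬ T (R w y)
    w⊀y w≺y = <-asym y<w (increasing w y w≺y)
    forbidden : Dec (T (R z w)) → ⊥
    forbidden (yes z≺w) = noN (x , z , w , y , x≺w , z≺w , z≺y , x∥z , x∥y , Incomp-sym y∥w)
    forbidden (no  z⊀w) = no2+2 (z , y , x , w , z≺y , x≺w , Incomp-sym x∥z , z∥w , Incomp-sym x∥y , y∥w)
      where
      z∥w : Incomp R z w
      z∥w = (λ { refl → w⊀y z≺y }) , z⊀w , λ w≺z → w⊀y (transitive w z y w≺z z≺y)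

  threshold-nests : ∀ x y → toℕ x < toℕ y → toℕ y < threshold R x → threshold R y ≤ threshold R x
  threshold-nests x y x<y y<θ with n ≤? threshold R x
  ... | yes n≤θ = ≤-trans (firstTrue-≤ (R y)) n≤θ
  ... | no  n≰θ with firstTrue-holds (R x) (≰⇒> n≰θ)
  ...   | w , w≡θ , x≺w =
    subst (threshold R y ≤_) w≡θ (R⇒threshold-≤ R (successor-shared x<y x⊀y x≺w (subst (toℕ y <_) (sym w≡θ) y<θ)))
    where
    x⊀y : ¬ T (R x y)
    x⊀y x≺y = <⇒≱ y<θ (R⇒threshold-≤ R x≺y)

  threshold-nested : Nested n (extend (threshold R))
  threshold-nested = extend-nested (Admissible.threshold-above adm) (firstTrue-≤ ∘ R) threshold-nests

AV22N-admissible : ∀ {n} (P : AV22N n) → IdAdmissible (proj₁ P)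
AV22N-admissible P = proj₂ (proj₁ (proj₂ P))

AV22N-nested : ∀ {n} (P : AV22N n) → Nested n (extend (threshold (proj₁ P)))
AV22N-nested (_ , (((_ , transitive) , no2+2) , adm) , noN) = threshold-nested transitive no2+2 noN adm

≤-of-thresholds : ∀ {n a b} → a ≤ n → (∀ (y : Fin n) → b ≤ toℕ y → a ≤ toℕ y) → a ≤ b
≤-of-thresholds {n} {a} {b} a≤n above-b with n ≤? b
... | yes n≤b = ≤-trans a≤n n≤b
... | no  n≰b with asFin (≰⇒> n≰b)
...   | y , refl = above-b y ≤-refl

threshold-nestedOrder : ∀ {n h} → Nested n h → ∀ (x : Fin n) → threshold (nestedOrder h) x ≡ h (toℕ x)
threshold-nestedOrder {h = h} N x = ≤-antisym
  (≤-of-thresholds (firstTrue-≤ (nestedOrder h x)) λ y hx≤y → R⇒threshold-≤ (nestedOrder h) (≤⇒≤ᵇ hx≤y))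
  (≤-of-thresholds (bounded N (toℕ<n x)) λ y θ≤y → ≤ᵇ⇒≤ _ _ (Admissible.threshold-≤⇒R (NestedOrder.admissible N) θ≤y))

nestedOrder-threshold : ∀ {n} h {R : BRel n} → IdAdmissible R → (∀ x → h (toℕ x) ≡ threshold R x) →
  nestedOrder h ≐R R
nestedOrder-threshold h {R} adm h≡θ x y =
    (λ x≺y → threshold-≤⇒R (subst (_≤ toℕ y) (h≡θ x) (≤ᵇ⇒≤ _ _ x≺y)))
  , (λ x≺y → ≤⇒≤ᵇ (subst (_≤ toℕ y) (sym (h≡θ x)) (R⇒threshold-≤ R x≺y)))
  where open Admissible adm

threshold-antitone : ∀ {n} {R S : BRel n} → IdAdmissible S → (∀ x y → T (S x y) → T (R x y)) →
  ∀ x → threshold R x ≤ threshold S x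
threshold-antitone {R = R} {S} adm S⊆R x =
  ≤-of-thresholds (firstTrue-≤ (R x)) λ y θ≤y → R⇒threshold-≤ R (S⊆R x y (Admissible.threshold-≤⇒R adm θ≤y))

threshold-≤⇒⊆ : ∀ {n} {R S : BRel n} → IdAdmissible R → (∀ x → threshold R x ≤ threshold S x) →
  ∀ x y → T (S x y) → T (R x y)
threshold-≤⇒⊆ {S = S} adm θ≤ x y x≺y = Admissible.threshold-≤⇒R adm (≤-trans (θ≤ x) (R⇒threshold-≤ S x≺y))

treeOf : ∀ {n} (P : AV22N n) → ∃[ t ] internal t ≡ n × reach t ≗[ n ] extend (threshold (proj₁ P))
treeOf P = nested⇒tree (AV22N-nested P)

toTamari : ∀ {n} → AV22N n → Tamari n
toTamari P = proj₁ (treeOf P) , proj₁ (proj₂ (treeOf P))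

reach-toTamari : ∀ {n} (P : AV22N n) x → reach (proj₁ (toTamari P)) (toℕ x) ≡ threshold (proj₁ P) x
reach-toTamari P x = trans (proj₂ (proj₂ (treeOf P)) (toℕ<n x)) (extend-toℕ _ x)

Tamari-nested : ∀ {n} (t : Tamari n) → Nested n (reach (proj₁ t))
Tamari-nested (t , refl) = reach-nested t

toPoset : ∀ {n} → Tamari n → AV22N n
toPoset t = NestedOrder.av22n (Tamari-nested t)

toTamari-toPoset : ∀ {n} (t : Tamari n) → toTamari (toPoset t) ≡ t
toTamari-toPoset t = Tamari-injective _ t (≗[]-fromFin λ x →
  trans (reach-toTamari (toPoset t) x) (threshold-nestedOrder (Tamari-nested t) x))

toPoset-toTamari : ∀ {n} (P : AV22N n) → proj₁ (toPoset (toTamari P)) ≐R proj₁ P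
toPoset-toTamari P = nestedOrder-threshold (reach (proj₁ (toTamari P))) (AV22N-admissible P) (reach-toTamari P)

≤T⇒≤Tam : ∀ {n} (P Q : AV22N n) → P ≤T Q → toTamari P ≤Tam toTamari Q
≤T⇒≤Tam P Q P≤Q = reach-≤⇒≤Tam (toTamari P) (toTamari Q) (≤[]-fromFin λ x →
  subst₂ _≤_ (sym (reach-toTamari P x)) (sym (reach-toTamari Q x)) (threshold-antitone (AV22N-admissible Q) P≤Q x))

≤Tam⇒≤T : ∀ {n} (P Q : AV22N n) → toTamari P ≤Tam toTamari Q → P ≤T Q
≤Tam⇒≤T P Q P≤Q = threshold-≤⇒⊆ (AV22N-admissible P) λ x →
  subst₂ _≤_ (reach-toTamari P x) (reach-toTamari Q x) (≤Tam⇒reach-≤ (toTamari P) (toTamari Q) P≤Q (toℕ<n x))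

mainTheorem8 : (n : ℕ) → 1 ≤ n →
    Σ (AV22N n → Tamari n) λ f → Σ (Tamari n → AV22N n) λ g →
      (∀ t → f (g t) ≡ t) ×
      (∀ P → proj₁ (g (f P)) ≐R proj₁ P) ×
      (∀ P Q → (P ≤T Q → f P ≤Tam f Q) × (f P ≤Tam f Q → P ≤T Q))
mainTheorem8 n _ = toTamari , toPoset , toTamari-toPoset , toPoset-toTamari , λ P Q → ≤T⇒≤Tam P Q , ≤Tam⇒≤T P Q
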